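{- For every integer $r\ge 2$, every nonempty graph $G$ without isolated vertices and every $n$, $$\mathrm{ex}_{K_r}(n,G)=\mathrm{ex}_r^{lin}(n,G).$$
   Context: All graphs are simple. $\mathrm{ex}_F(n,G)$ is the maximum $k$ such that there exist $k$ pairwise edge-disjoint subgraphs $F_1,\dots,F_k$ of $K_n$, each isomorphic to $F$, such that $\bigcup_i F_i$ contains no subgraph $G'$ isomorphic to $G$ with $|E(G')\cap E(F_i)|\le 1$ for every $i$. An $r$-uniform hypergraph is linear if any two distinct hyperedges share at most one vertex. A hypergraph $\mathcal{H}$ is a Berge copy of $G$ (Berge-$G$) if one can choose, injectively, a 2-element subset of each hyperedge of $\mathcal{H}$ so that the chosen pairs form a copy of $G$; $\mathcal{H}$ is Berge-$G$-free if it has no subhypergraph that is a Berge-$G$. $\mathrm{ex}_r^{lin}(n,G)$ is the maximum number of hyperedges of a Berge-$G$-free linear $r$-uniform hypergraph on $n$ vertices. -}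

module Defs where

open import Data.Nat using (ℕ; _≤_; _<_)
open import Data.Fin using (Fin)
open import Data.Product using (Σ; ∃; _×_; _,_)
open import Data.Sum using (_⊎_)
open import Relation.Binary.PropositionalEquality using (_≡_; _≢_)
open import Relation.Nullary using (¬_)
open import Function.Definitions using (Injective)

record Graph : Set where
  field
    nv ne : ℕ
    src tgt : Fin ne → Fin nv
    loopless : ∀ i → src i ≢ tgt i
    simple : ∀ i j →
      ((src i ≡ src j × tgt i ≡ tgt j) ⊎ (src i ≡ tgt j × tgt i ≡ src j)) →
      i ≡ j

open Graph public

NonemptyGraph : Graph → Set
NonemptyGraph G = 0 < ne G

NoIsolatedVertices : Graph → Set
NoIsolatedVertices G = ∀ x → ∃ λ i → (src G i ≡ x) ⊎ (tgt G i ≡ x)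

Inj : {a b : ℕ} → (Fin a → Fin b) → Set
Inj f = Injective _≡_ _≡_ f

_∈img_ : {a b : ℕ} → Fin b → (Fin a → Fin b) → Set
x ∈img f = ∃ λ j → f j ≡ x

-- A copy of K_r in K_n is given by an injective map Fin r → Fin n
-- (the complete graph on its image).  {a,b} is an edge of that copy:
EdgeOf : {r n : ℕ} → (Fin r → Fin n) → Fin n → Fin n → Set
EdgeOf K a b = a ≢ b × a ∈img K × b ∈img K

KrPacking : (r n : ℕ) → Graph → (k : ℕ) → (Fin k → Fin r → Fin n) → Set
KrPacking r n G k F =
  (∀ i → Inj (F i)) ×
  (∀ i j → i ≢ j → ∀ a b → ¬ (EdgeOf (F i) a b × EdgeOf (F j) a b)) ×
  -- no copy G' of G in the union with |E(G') ∩ E(F_i)| ≤ 1 for all i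
  ¬ (Σ (Fin (nv G) → Fin n) λ φ →
       Inj φ ×
       (∀ e → ∃ λ j → EdgeOf (F j) (φ (src G e)) (φ (tgt G e))) ×
       (∀ j e e' → EdgeOf (F j) (φ (src G e)) (φ (tgt G e)) →
                   EdgeOf (F j) (φ (src G e')) (φ (tgt G e')) → e ≡ e'))

KrPackable : (r n : ℕ) → Graph → ℕ → Set
KrPackable r n G k = Σ (Fin k → Fin r → Fin n) λ F → KrPacking r n G k F

IsMax : (ℕ → Set) → ℕ → Set
IsMax P m = P m × (∀ k → P k → k ≤ m)

IsExKr : (r n : ℕ) → Graph → ℕ → Set
IsExKr r n G = IsMax (KrPackable r n G)

-- r-uniform hypergraph on Fin n with hyperedges indexed by Fin m:
-- hyperedge i is the r-element image of the injective map H i.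
-- Linear: distinct hyperedges share at most one vertex.
Linear : {r n m : ℕ} → (Fin m → Fin r → Fin n) → Set
Linear {m = m} H = ∀ i j → i ≢ j → ∀ a b →
  a ∈img H i → b ∈img H i → a ∈img H j → b ∈img H j → a ≡ b

-- H contains a Berge copy of G: a copy of G (injective φ) together with
-- an injective choice ψ of a hyperedge containing each edge of the copy.
BergeContains : {r n m : ℕ} → (Fin m → Fin r → Fin n) → Graph → Set
BergeContains {n = n} {m = m} H G =
  Σ (Fin (nv G) → Fin n) λ φ → Inj φ ×
  Σ (Fin (ne G) → Fin m) λ ψ → Inj ψ ×
  (∀ e → (φ (src G e) ∈img H (ψ e)) × (φ (tgt G e) ∈img H (ψ e)))

LinBergeFree : (r n : ℕ) → Graph → ℕ → Set
LinBergeFree r n G m = Σ (Fin m → Fin r → Fin n) λ H →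
  (∀ i → Inj (H i)) × Linear H × ¬ BergeContains H G

IsExLin : (r n : ℕ) → Graph → ℕ → Set
IsExLin r n G = IsMax (LinBergeFree r n G)

{-# OPTIONS --safe #-}
module Submission where

-- A family of injective maps Fin r → Fin n is read both as K_r-copies in K_n and as
-- r-uniform hyperedges.  Two copies share an edge exactly when the two hyperedges share
-- two vertices, so edge-disjointness is linearity; and in an edge-disjoint family the
-- copy containing an edge is unique, so a copy of G meeting every K_r-copy in at most
-- one edge is the same thing as a Berge copy of G.  Hence the two admissible classes
-- coincide for every k and have the same maximum.

open import Defs
open import Data.Nat using (ℕ; _≤_)
open import Data.Fin using (Fin; _≟_)
open import Data.Product using (Σ; ∃; _×_; _,_; proj₁; proj₂)
open import Data.Empty using (⊥-elim)
open import Function.Bundles using (_⇔_; mk⇔; Equivalence)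
open import Relation.Nullary using (yes; no; ¬_)
open import Relation.Binary.PropositionalEquality using (_≡_; _≢_; sym; trans; subst)

IsMax-cong : {P Q : ℕ → Set} → (∀ k → P k ⇔ Q k) → ∀ m → IsMax P m ⇔ IsMax Q m
IsMax-cong P⇔Q m = mk⇔
  (λ (Pm , maxP) → to (P⇔Q m) Pm , λ k Qk → maxP k (from (P⇔Q k) Qk))
  (λ (Qm , maxQ) → from (P⇔Q m) Qm , λ k Pk → maxQ k (to (P⇔Q k) Pk))
  where open Equivalence

module _ {r n k : ℕ} (F : Fin k → Fin r → Fin n) where

  EdgeDisjoint : Set
  EdgeDisjoint = ∀ i j → i ≢ j → ∀ a b → ¬ (EdgeOf (F i) a b × EdgeOf (F j) a b)

  edgeDisjoint⇒linear : EdgeDisjoint → Linear F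
  edgeDisjoint⇒linear disj i j i≢j a b a∈i b∈i a∈j b∈j with a ≟ b
  ... | yes a≡b = a≡b
  ... | no a≢b = ⊥-elim (disj i j i≢j a b ((a≢b , a∈i , b∈i) , (a≢b , a∈j , b∈j)))

  linear⇒edgeDisjoint : Linear F → EdgeDisjoint
  linear⇒edgeDisjoint lin i j i≢j a b ((a≢b , a∈i , b∈i) , (_ , a∈j , b∈j)) =
    a≢b (lin i j i≢j a b a∈i b∈i a∈j b∈j)

  edgeDisjoint-unique : EdgeDisjoint → ∀ {i j a b} → EdgeOf (F i) a b → EdgeOf (F j) a b → i ≡ j
  edgeDisjoint-unique disj {i} {j} {a} {b} ab∈i ab∈j with i ≟ j
  ... | yes i≡j = i≡j
  ... | no i≢j = ⊥-elim (disj i j i≢j a b (ab∈i , ab∈j))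

  module _ (G : Graph) where

    SparseCopy : Set
    SparseCopy = Σ (Fin (nv G) → Fin n) λ φ →
      Inj φ ×
      (∀ e → ∃ λ j → EdgeOf (F j) (φ (src G e)) (φ (tgt G e))) ×
      (∀ j e e' → EdgeOf (F j) (φ (src G e)) (φ (tgt G e)) →
                  EdgeOf (F j) (φ (src G e')) (φ (tgt G e')) → e ≡ e')

    sparseCopy⇒bergeContains : SparseCopy → BergeContains F G
    sparseCopy⇒bergeContains (φ , φ-inj , cover , sparse) = φ , φ-inj , ψ , ψ-inj , ends∈ψ
      where
      ψ : Fin (ne G) → Fin k
      ψ e = proj₁ (cover e)

      e∈ψ : ∀ e → EdgeOf (F (ψ e)) (φ (src G e)) (φ (tgt G e))
      e∈ψ e = proj₂ (cover e)

      ψ-inj : Inj ψ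
      ψ-inj {e} {e'} ψe≡ψe' =
        sparse (ψ e) e e' (e∈ψ e)
          (subst (λ j → EdgeOf (F j) (φ (src G e')) (φ (tgt G e'))) (sym ψe≡ψe') (e∈ψ e'))

      ends∈ψ : ∀ e → (φ (src G e) ∈img F (ψ e)) × (φ (tgt G e) ∈img F (ψ e))
      ends∈ψ e = let (_ , s∈ , t∈) = e∈ψ e in s∈ , t∈

    bergeContains⇒sparseCopy : EdgeDisjoint → BergeContains F G → SparseCopy
    bergeContains⇒sparseCopy disj (φ , φ-inj , ψ , ψ-inj , ends∈ψ) = φ , φ-inj , cover , sparse
      where
      e∈ψ : ∀ e → EdgeOf (F (ψ e)) (φ (src G e)) (φ (tgt G e))
      e∈ψ e = (λ s≡t → loopless G e (φ-inj s≡t)) , proj₁ (ends∈ψ e) , proj₂ (ends∈ψ e)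

      cover : ∀ e → ∃ λ j → EdgeOf (F j) (φ (src G e)) (φ (tgt G e))
      cover e = ψ e , e∈ψ e

      sparse : ∀ j e e' → EdgeOf (F j) (φ (src G e)) (φ (tgt G e)) →
                          EdgeOf (F j) (φ (src G e')) (φ (tgt G e')) → e ≡ e'
      sparse j e e' e∈j e'∈j =
        ψ-inj (trans (sym (edgeDisjoint-unique disj e∈j (e∈ψ e)))
                     (edgeDisjoint-unique disj e'∈j (e∈ψ e')))

KrPackable⇔LinBergeFree : ∀ r n G k → KrPackable r n G k ⇔ LinBergeFree r n G k
KrPackable⇔LinBergeFree r n G k = mk⇔
  (λ (F , inj , disj , noSparse) →
     F , inj , edgeDisjoint⇒linear F disj ,
     λ berge → noSparse (bergeContains⇒sparseCopy F G disj berge))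
  (λ (H , inj , lin , noBerge) →
     H , inj , linear⇒edgeDisjoint H lin , λ sparse → noBerge (sparseCopy⇒bergeContains H G sparse))

proposition5 : (r : ℕ) → 2 ≤ r → (G : Graph) → NonemptyGraph G → NoIsolatedVertices G →
    (n m : ℕ) → IsExKr r n G m ⇔ IsExLin r n G m
proposition5 r _ G _ _ n = IsMax-cong (KrPackable⇔LinBergeFree r n G)
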